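{- Let $G$ be a connected $C_4$-free graph and let $u\in V(G)$ be a vertex such that $\chi_D(G[N_G[u]])\leq \Delta(G)$. Then $\chi_D(G)\leq \Delta(G)+1$.
   Context: All graphs are finite and simple. $G$ is $C_4$-free if it has no induced subgraph isomorphic to the 4-cycle $C_4$. $N_G[u]$ is the closed neighbourhood of $u$ and $G[X]$ the subgraph induced by $X$. For a proper vertex colouring $c$ of a graph $H$, $c$ is distinguishing if the identity is the only automorphism $\varphi$ of $H$ with $c(\varphi(v))=c(v)$ for all $v\in V(H)$. The distinguishing chromatic number $\chi_D(H)$ is the minimum number of colours in a proper distinguishing vertex colouring of $H$. $\Delta(G)$ is the maximum degree of $G$. -}

module Defs where

open import Data.Nat using (ℕ; zero; suc; _⊔_; _≤_; _+_)
open import Data.Fin using (Fin)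
open import Data.Fin.Properties using () renaming (_≟_ to _≟ᶠ_)
open import Data.Bool using (Bool; true; false; T; _∨_; if_then_else_)
open import Data.List using (List; map; foldr; allFin)
open import Data.Nat.ListAction using (sum)
open import Data.Empty using (⊥)
open import Data.Product using (Σ; _,_; proj₁; ∃; _×_)
open import Relation.Binary.PropositionalEquality using (_≡_)
open import Relation.Nullary using (¬_; does)

record Graph (V : Set) : Set where
  field
    adj    : V → V → Bool
    adjSym : ∀ x y → adj x y ≡ adj y x
    irrefl : ∀ x → adj x x ≡ false
open Graph public

Adj : {V : Set} → Graph V → V → V → Set
Adj G x y = T (adj G x y)

induced : {V : Set} → (G : Graph V) → (X : V → Bool) → Graph (Σ V (λ v → T (X v)))
induced G X = record
  { adj    = λ x y → adj G (proj₁ x) (proj₁ y)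
  ; adjSym = λ x y → adjSym G (proj₁ x) (proj₁ y)
  ; irrefl = λ x → irrefl G (proj₁ x) }

closedNbhd : {n : ℕ} → Graph (Fin n) → Fin n → Fin n → Bool
closedNbhd G u v = does (v ≟ᶠ u) ∨ adj G u v

record Automorphism {V : Set} (G : Graph V) : Set where
  field
    to      : V → V
    from    : V → V
    to∘from : ∀ x → to (from x) ≡ x
    from∘to : ∀ x → from (to x) ≡ x
    preserv : ∀ x y → adj G (to x) (to y) ≡ adj G x y
open Automorphism public

Proper : {V : Set} → Graph V → {k : ℕ} → (V → Fin k) → Set
Proper G c = ∀ x y → Adj G x y → ¬ (c x ≡ c y)

Distinguishing : {V : Set} → (G : Graph V) → {k : ℕ} → (V → Fin k) → Set
Distinguishing G c =
  (φ : Automorphism G) → (∀ v → c (to φ v) ≡ c v) → ∀ v → to φ v ≡ v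

-- χ_D(G) ≤ k  (χ_D is a minimum over numbers of colours, so χ_D(G) ≤ k
-- holds iff there is a proper distinguishing colouring using colours from
-- a k-element set).
χD≤ : {V : Set} → Graph V → ℕ → Set
χD≤ G k = Σ (_ → Fin k) (λ c → Proper G c × Distinguishing G c)

degree : {n : ℕ} → Graph (Fin n) → Fin n → ℕ
degree {n} G v = sum (map (λ w → if adj G v w then 1 else 0) (allFin n))

Δ : {n : ℕ} → Graph (Fin n) → ℕ
Δ {n} G = foldr _⊔_ 0 (map (degree G) (allFin n))

data Walk {V : Set} (G : Graph V) : V → V → Set where
  here : ∀ {x} → Walk G x x
  step : ∀ {x y z} → Adj G x y → Walk G y z → Walk G x z

Connected : {V : Set} → Graph V → Set
Connected {V} G = ∀ (x y : V) → Walk G x y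

C4Free : {V : Set} → Graph V → Set
C4Free G = ∀ a b c d →
  ¬ (a ≡ c) → ¬ (b ≡ d) →
  Adj G a b → Adj G b c → Adj G c d → Adj G d a →
  ¬ Adj G a c → ¬ Adj G b d → ⊥

-- Order the vertices breadth-first from u. Colour u with 0 and every other a ∈ N[u] with
-- 1 + c₀ a, then colour the remaining vertices greedily in this order: v avoids the colours of
-- its earlier neighbours and of its earlier non-adjacent twins (vertices w agreeing with v on
-- all vertices before w), and takes 0 only if it then sees every colour 1 … Δ. If v has such a
-- twin, C₄-freeness puts all these vertices into the closed neighbourhood of the parent y of v,
-- which also contains v and the parent of y, so fewer than Δ colours are excluded; otherwise
-- they are at most Δ neighbours of v, and if they exhaust 1 … Δ then 0 is free.
-- An automorphism preserving the colouring fixes u (were φ u far, it would be coloured 0 and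
-- see the colour 1 + c₀ u, which no neighbour of u has), hence N[u] as c₀ is distinguishing,
-- and then every vertex by induction along the order, since the earliest moved vertex would
-- go to a later twin of the same colour.

module Submission where

open import Defs
open import Data.Nat using (ℕ; zero; suc; pred; _+_; _*_; _^_; _⊔_; _≤_; _<_; z≤n; s≤s; ≢-nonZero)
open import Data.Nat.Properties
  using ( ≤-refl; ≤-reflexive; ≤-trans; ≤-antisym; <-irrefl; <-asym; <-trans; ≤-<-trans; <-≤-trans; <⇒≤; ≮⇒≥
        ; <-cmp; <⇒≱; m≤n⇒m≤1+n; m≤n⇒m<n∨m≡n; m<n⇒m<1+n; n≤1+n; n≤0⇒n≡0; m≤n+m; m≤m⊔n; m≤n⊔m; +-suc
        ; +-mono-≤; +-monoʳ-≤; +-monoˡ-<; *-monoˡ-≤; *-comm; *-assoc; ^-monoʳ-≤; suc-pred; ≤-pred; _<?_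
        ; module ≤-Reasoning)
  renaming (_≟_ to _≟ℕ_)
open import Data.Nat.DivMod
  using (_/_; _%_; %-congˡ; /-congˡ; [m+kn]%n≡m%n; m<n⇒m%n≡m; +-distrib-/-∣ʳ; m<n⇒m/n≡0; m*n/n≡m; /-monoˡ-≤)
open import Data.Nat.Divisibility using (n∣m*n)
open import Data.Nat.ListAction using (sum)
open import Data.Fin as Fin using (Fin; toℕ)
open import Data.Fin.Properties using (_≟_; any?; all?; suc-injective; 0≢1+n; injective⇒≤; toℕ<n; toℕ-injective)
open import Data.Bool using (Bool; true; false; T; if_then_else_; _∨_)
open import Data.Bool.Properties using (T?; T-∨; T-irrelevant) renaming (_≟_ to _≟ᵇ_)
open import Data.List using (List; []; _∷_; map; filter; length; foldr; allFin; lookup)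
open import Data.List.Properties using (length-map)
open import Data.Vec.Functional using (updateAt)
open import Data.Vec.Functional.Properties using (updateAt-updates; updateAt-minimal)
open import Data.List.Membership.Propositional using (_∈_; _∉_)
open import Data.List.Membership.Propositional.Properties using (∈-filter⁺; ∈-filter⁻; ∈-allFin; ∈-map⁺; ∈-map⁻)
open import Data.List.Relation.Unary.All as All using (All; []; _∷_)
open import Data.List.Relation.Unary.Any using (here; there; index)
open import Data.List.Relation.Unary.Any.Properties using (lookup-index)
open import Data.List.Relation.Unary.Unique.Propositional using (Unique)
open import Data.List.Relation.Unary.Unique.Propositional.Properties using (allFin⁺)
open import Data.List.Relation.Unary.AllPairs using () renaming ([] to []ᵘ; _∷_ to _∷ᵘ_)
open import Data.List.Extrema.Nat using (argmin; f[argmin]≤f[⊤]; f[argmin]≤f[xs]; argmin-sel)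
open import Data.Product using (Σ; ∃; _×_; _,_; proj₁; proj₂)
open import Data.Sum using (_⊎_; inj₁; inj₂; [_,_])
open import Data.Empty using (⊥-elim)
open import Function using (_∘_; id; const; flip; Injective)
open import Level using (0ℓ)
open import Function.Bundles using (Equivalence)
open import Relation.Nullary using (¬_; Dec; yes; no; does; contradiction)
open import Relation.Nullary.Decidable using (_×-dec_; _⊎-dec_; ¬?; decidable-stable; _→-dec_; ⌊_⌋; toWitness; fromWitness)
open import Relation.Unary using (Pred; Decidable; _⊆_; _∪_; ∁)
open import Relation.Unary.Properties using (_∪?_)
open import Relation.Binary.PropositionalEquality
  using (_≡_; _≢_; refl; sym; trans; cong; cong₂; subst; subst₂; module ≡-Reasoning)
open import Relation.Binary.Definitions using (tri<; tri≈; tri>)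

module _ {A : Set} where

  count : {P : Pred A 0ℓ} → Decidable P → List A → ℕ
  count P? xs = sum (map (λ x → if does (P? x) then 1 else 0) xs)

  module _ {P Q : Pred A 0ℓ} (P? : Decidable P) (Q? : Decidable Q) where

    count-mono : P ⊆ Q → ∀ xs → count P? xs ≤ count Q? xs
    count-mono P⊆Q [] = z≤n
    count-mono P⊆Q (x ∷ xs) with P? x | Q? x
    ... | yes _  | yes _  = s≤s (count-mono P⊆Q xs)
    ... | yes px | no ¬qx = contradiction (P⊆Q px) ¬qx
    ... | no _   | yes _  = m≤n⇒m≤1+n (count-mono P⊆Q xs)
    ... | no _   | no _   = count-mono P⊆Q xs

    count-strict-mono : P ⊆ Q → ∀ {a xs} → a ∈ xs → Q a → ¬ P a → count P? xs < count Q? xs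
    count-strict-mono P⊆Q {a} {_ ∷ xs} (here refl) qa ¬pa with P? a | Q? a
    ... | yes pa | _      = contradiction pa ¬pa
    ... | no _   | yes _  = s≤s (count-mono P⊆Q xs)
    ... | no _   | no ¬qa = contradiction qa ¬qa
    count-strict-mono P⊆Q {xs = x ∷ xs} (there a∈xs) qa ¬pa with P? x | Q? x
    ... | yes _  | yes _  = s≤s (count-strict-mono P⊆Q a∈xs qa ¬pa)
    ... | yes px | no ¬qx = contradiction (P⊆Q px) ¬qx
    ... | no _   | yes _  = m<n⇒m<1+n (count-strict-mono P⊆Q a∈xs qa ¬pa)
    ... | no _   | no _   = count-strict-mono P⊆Q a∈xs qa ¬pa

    count-∪ : ∀ xs → count (P? ∪? Q?) xs ≤ count P? xs + count Q? xs
    count-∪ [] = z≤n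
    count-∪ (x ∷ xs) with P? x | Q? x
    ... | yes _ | yes _ = s≤s (≤-trans (count-∪ xs) (+-monoʳ-≤ (count P? xs) (n≤1+n _)))
    ... | yes _ | no _  = s≤s (count-∪ xs)
    ... | no _  | yes _ = ≤-trans (s≤s (count-∪ xs)) (≤-reflexive (sym (+-suc _ _)))
    ... | no _  | no _  = count-∪ xs

  count-none : {P : Pred A 0ℓ} (P? : Decidable P) → ∀ {xs} → All (∁ P) xs → count P? xs ≡ 0
  count-none P? [] = refl
  count-none P? {x ∷ _} (¬px ∷ ¬ps) with P? x
  ... | yes px = contradiction px ¬px
  ... | no _   = count-none P? ¬ps

  length-filter≡count : {P : Pred A 0ℓ} (P? : Decidable P) → ∀ xs → length (filter P? xs) ≡ count P? xs
  length-filter≡count P? [] = refl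
  length-filter≡count P? (x ∷ xs) with does (P? x)
  ... | true  = cong suc (length-filter≡count P? xs)
  ... | false = length-filter≡count P? xs

  cover⇒≤length : ∀ {m} {f : Fin m → A} → Injective _≡_ _≡_ f → ∀ {xs} → (∀ i → f i ∈ xs) → m ≤ length xs
  cover⇒≤length {f = f} f-inj {xs} cover = injective⇒≤ (λ {i} {j} eq → f-inj (begin
    f i                        ≡⟨ lookup-index (cover i) ⟩
    lookup xs (index (cover i)) ≡⟨ cong (lookup xs) eq ⟩
    lookup xs (index (cover j)) ≡⟨ lookup-index (cover j) ⟨
    f j                        ∎))
    where open ≡-Reasoning

  -- Unlike argmin, whose default competes with the list elements, the fallback is only
  -- returned for [].
  argmin⁺ : (A → ℕ) → A → List A → A
  argmin⁺ f fallback []       = fallback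
  argmin⁺ f fallback (y ∷ ys) = argmin f y ys

  argmin⁺-∈ : ∀ (f : A → ℕ) (fallback : A) {z xs} → z ∈ xs → argmin⁺ f fallback xs ∈ xs
  argmin⁺-∈ f _ {xs = y ∷ ys} _ with argmin-sel f y ys
  ... | inj₁ argmin≡y  = here argmin≡y
  ... | inj₂ argmin∈ys = there argmin∈ys

  argmin⁺-≤ : ∀ (f : A → ℕ) (fallback : A) {z xs} → z ∈ xs → f (argmin⁺ f fallback xs) ≤ f z
  argmin⁺-≤ f _ {xs = y ∷ ys} (here refl)  = f[argmin]≤f[⊤] {f = f} y ys
  argmin⁺-≤ f _ {xs = y ∷ ys} (there z∈ys) = All.lookup (f[argmin]≤f[xs] {f = f} y ys) z∈ys

count-≟-≤1 : ∀ {n} (a : Fin n) {xs} → Unique xs → count (_≟ a) xs ≤ 1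
count-≟-≤1 a []ᵘ = z≤n
count-≟-≤1 a {x ∷ _} (x∉xs ∷ᵘ unique) with x ≟ a
... | yes refl = s≤s (≤-reflexive (count-none (_≟ a) (All.map (λ x≢z z≡x → x≢z (sym z≡x)) x∉xs)))
... | no _     = count-≟-≤1 a unique

∈⇒≤foldr⊔ : ∀ {m ms} → m ∈ ms → m ≤ foldr _⊔_ 0 ms
∈⇒≤foldr⊔ (here refl)  = m≤m⊔n _ _
∈⇒≤foldr⊔ {ms = m′ ∷ _} (there m∈ms) = ≤-trans (∈⇒≤foldr⊔ m∈ms) (m≤n⊔m m′ _)

least : (ℕ → Bool) → ℕ → ℕ
least f zero    = 0
least f (suc m) = if f (least f m) then least f m else suc m

least-true : ∀ (f : ℕ → Bool) {m j} → j ≤ m → T (f j) → T (f (least f m))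
least-true f {zero} z≤n fj = fj
least-true f {suc m} {j} j≤1+m fj with f (least f m) in eq
... | true  = subst T (sym eq) _
... | false with m≤n⇒m<n∨m≡n j≤1+m
...   | inj₁ j<1+m = contradiction (subst T eq (least-true f (≤-pred j<1+m) fj)) λ ()
...   | inj₂ refl = fj

least-minimal : ∀ (f : ℕ → Bool) {m j} → j < least f m → ¬ T (f j)
least-minimal f {suc m} {j} j<least fj with f (least f m) in eq
... | true  = least-minimal f {m} j<least fj
... | false = subst T eq (least-true f (≤-pred j<least) fj)

-- Breadth-first orders

module _ {n : ℕ} (G : Graph (Fin n)) where

  Adj? : ∀ x y → Dec (Adj G x y)
  Adj? x y = T? (adj G x y)

  Adj-sym : ∀ {x y} → Adj G x y → Adj G y x
  Adj-sym {x} {y} = subst T (adjSym G x y)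

  Adj-irrefl : ∀ {x} → ¬ Adj G x x
  Adj-irrefl {x} = subst T (irrefl G x)

  Adj⇒≢ : ∀ {x y} → Adj G x y → x ≢ y
  Adj⇒≢ xy refl = Adj-irrefl xy

  degree≤Δ : ∀ v → degree G v ≤ Δ G
  degree≤Δ v = ∈⇒≤foldr⊔ (∈-map⁺ (degree G) (∈-allFin v))

  walkLength : ∀ {x y} → Walk G x y → ℕ
  walkLength here       = 0
  walkLength (step _ w) = suc (walkLength w)

record BreadthFirstOrder {n : ℕ} (G : Graph (Fin n)) (u : Fin n) : Set where
  field
    rank            : Fin n → ℕ
    parent          : Fin n → Fin n
    rank-injective  : ∀ {x y} → rank x ≡ rank y → x ≡ y
    root-first      : ∀ {x} → x ≢ u → rank u < rank x
    parent-adj      : ∀ {x} → x ≢ u → Adj G x (parent x)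
    parent-earlier  : ∀ {x} → x ≢ u → rank (parent x) < rank x
    parent-earliest : ∀ {x z} → x ≢ u → Adj G x z → rank (parent x) ≤ rank z
    parent-mono     : ∀ {x y} → x ≢ u → y ≢ u → rank x < rank y → rank (parent x) ≤ rank (parent y)

module BreadthFirstSearch {n : ℕ} (G : Graph (Fin n)) (connected : Connected G) (u : Fin n) where

  within : ℕ → Fin n → Bool
  within zero    x = ⌊ x ≟ u ⌋
  within (suc k) x = within k x ∨ ⌊ any? (λ y → Adj? G x y ×-dec T? (within k y)) ⌋

  within-root : T (within 0 u)
  within-root = fromWitness refl

  within-step : ∀ {k x y} → Adj G x y → T (within k y) → T (within (suc k) x)
  within-step {k} {x} xy y-within = Equivalence.from (T-∨ {within k x})
    (inj₂ (fromWitness {a? = any? λ y → Adj? G x y ×-dec T? (within k y)} (_ , xy , y-within)))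

  within-suc⁻ : ∀ {k x} → T (within (suc k) x) → T (within k x) ⊎ ∃ λ y → Adj G x y × T (within k y)
  within-suc⁻ x-within with Equivalence.to T-∨ x-within
  ... | inj₁ earlier = inj₁ earlier
  ... | inj₂ viaNeighbour = inj₂ (toWitness viaNeighbour)

  walk⇒within : ∀ {x} (w : Walk G x u) → T (within (walkLength G w) x)
  walk⇒within here       = within-root
  walk⇒within (step xy w) = within-step {walkLength G w} xy (walk⇒within w)

  searchBound : Fin n → ℕ
  searchBound x = walkLength G (connected x u)

  dist : Fin n → ℕ
  dist x = least (λ k → within k x) (searchBound x)

  within-dist : ∀ x → T (within (dist x) x)
  within-dist x = least-true (λ k → within k x) {searchBound x} ≤-refl (walk⇒within (connected x u))

  below-dist : ∀ {x k} → k < dist x → ¬ T (within k x)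
  below-dist {x} = least-minimal (λ k → within k x) {searchBound x}

  dist-minimal : ∀ {x k} → T (within k x) → dist x ≤ k
  dist-minimal x-within = ≮⇒≥ (λ k<dist → below-dist k<dist x-within)

  dist-root : dist u ≡ 0
  dist-root = n≤0⇒n≡0 (dist-minimal within-root)

  dist≡0⇒root : ∀ {x} → dist x ≡ 0 → x ≡ u
  dist≡0⇒root {x} eq = toWitness (subst (λ k → T (within k x)) eq (within-dist x))

  dist-adj : ∀ {x y} → Adj G x y → dist y ≤ suc (dist x)
  dist-adj {x} xy = dist-minimal (within-step {dist x} (Adj-sym G xy) (within-dist x))

  dist-pred : ∀ {x d} → dist x ≡ suc d → ∃ λ y → Adj G x y × dist y ≡ d
  dist-pred {x} {d} eq with within-suc⁻ {d} (subst (λ k → T (within k x)) eq (within-dist x))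
  ... | inj₁ x-within = contradiction x-within (below-dist (≤-reflexive (sym eq)))
  ... | inj₂ (y , xy , y-within) =
    y , xy , ≤-antisym (dist-minimal y-within) (≤-pred (subst (_≤ suc (dist y)) eq (dist-adj (Adj-sym G xy))))

  dist-nonroot : ∀ {x} → x ≢ u → dist x ≡ suc (pred (dist x))
  dist-nonroot x≢u = sym (suc-pred _ {{≢-nonZero (x≢u ∘ dist≡0⇒root)}})

  M : ℕ
  M = suc n

  toℕ<M : ∀ (x : Fin n) → toℕ x < M
  toℕ<M x = ≤-trans (toℕ<n x) (n≤1+n n)

  candidate? : ∀ x d y → Dec (Adj G x y × dist y ≡ d)
  candidate? x d y = Adj? G x y ×-dec (dist y ≟ℕ d)

  candidates : ℕ → Fin n → List (Fin n)
  candidates d x = filter (candidate? x d) (allFin n)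

  -- For x at distance d, key d x is the base-M numeral 1 t_{d-1} … t_0 with t_i = toℕ x_i
  -- along the path x = x_0, x_1, …, x_d = u, each x_{i+1} being the neighbour of x_i one
  -- step closer to u with least key. Comparing keys thus compares distances first and then
  -- parents' keys, which is exactly a breadth-first search order.
  key : ℕ → Fin n → ℕ
  parentAt : ℕ → Fin n → Fin n

  key zero    x = 1
  key (suc d) x = toℕ x + key d (parentAt d x) * M

  parentAt d x = argmin⁺ (key d) x (candidates d x)

  parentAt-spec : ∀ {x d} → dist x ≡ suc d → Adj G x (parentAt d x) × dist (parentAt d x) ≡ d
  parentAt-spec {x} {d} eq =
    let (y , xy , dist-y) = dist-pred eq
    in proj₂ (∈-filter⁻ (candidate? x d) {xs = allFin n}
                (argmin⁺-∈ (key d) x (∈-filter⁺ (candidate? x d) (∈-allFin y) (xy , dist-y))))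

  parentAt-least : ∀ {x z d} → Adj G x z → dist z ≡ d → key d (parentAt d x) ≤ key d z
  parentAt-least {x} {z} {d} xz dist-z = argmin⁺-≤ (key d) x (∈-filter⁺ (candidate? x d) (∈-allFin z) (xz , dist-z))

  key-bounds : ∀ d x → dist x ≡ d → M ^ d ≤ key d x × key d x < 2 * M ^ d
  key-bounds zero    x _  = ≤-refl , s≤s (s≤s z≤n)
  key-bounds (suc d) x eq = lower , upper
    where
    k : ℕ
    k = key d (parentAt d x)
    bounds : M ^ d ≤ k × k < 2 * M ^ d
    bounds = key-bounds d (parentAt d x) (proj₂ (parentAt-spec eq))
    open ≤-Reasoning
    lower : M ^ suc d ≤ toℕ x + k * M
    lower = begin
      M * M ^ d ≡⟨ *-comm M (M ^ d) ⟩
      M ^ d * M ≤⟨ *-monoˡ-≤ M (proj₁ bounds) ⟩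
      k * M     ≤⟨ m≤n+m (k * M) (toℕ x) ⟩
      toℕ x + k * M ∎
    upper : toℕ x + k * M < 2 * M ^ suc d
    upper = begin-strict
      toℕ x + k * M     <⟨ +-monoˡ-< (k * M) (toℕ<M x) ⟩
      suc k * M         ≤⟨ *-monoˡ-≤ M (proj₂ bounds) ⟩
      2 * M ^ d * M     ≡⟨ *-assoc 2 (M ^ d) M ⟩
      2 * (M ^ d * M)   ≡⟨ cong (2 *_) (*-comm (M ^ d) M) ⟩
      2 * M ^ suc d     ∎

  rank : Fin n → ℕ
  rank x = key (dist x) x

  parent : Fin n → Fin n
  parent x = parentAt (pred (dist x)) x

  2≤M : 2 ≤ M
  2≤M = s≤s (≤-<-trans z≤n (toℕ<n u))

  dist<⇒rank< : ∀ {x y} → dist x < dist y → rank x < rank y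
  dist<⇒rank< {x} {y} dist-x<dist-y = begin-strict
    rank x                <⟨ proj₂ (key-bounds (dist x) x refl) ⟩
    2 * M ^ dist x         ≤⟨ *-monoˡ-≤ (M ^ dist x) 2≤M ⟩
    M ^ suc (dist x)       ≤⟨ ^-monoʳ-≤ M dist-x<dist-y ⟩
    M ^ dist y             ≤⟨ proj₁ (key-bounds (dist y) y refl) ⟩
    rank y                 ∎
    where open ≤-Reasoning

  rank≡⇒dist≡ : ∀ {x y} → rank x ≡ rank y → dist x ≡ dist y
  rank≡⇒dist≡ eq = ≤-antisym (≮⇒≥ (<-irrefl (sym eq) ∘ dist<⇒rank<)) (≮⇒≥ (<-irrefl eq ∘ dist<⇒rank<))

  parent-spec : ∀ {x} → x ≢ u → Adj G x (parent x) × dist (parent x) ≡ pred (dist x)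
  parent-spec x≢u = parentAt-spec (dist-nonroot x≢u)

  parent-dist : ∀ {x} → x ≢ u → suc (dist (parent x)) ≡ dist x
  parent-dist x≢u = trans (cong suc (proj₂ (parent-spec x≢u))) (sym (dist-nonroot x≢u))

  rank-digits : ∀ {x} → x ≢ u → rank x ≡ toℕ x + rank (parent x) * M
  rank-digits {x} x≢u = begin
    key (dist x) x                                 ≡⟨ cong (λ d → key d x) (dist-nonroot x≢u) ⟩
    toℕ x + key (pred (dist x)) (parent x) * M     ≡⟨ cong (λ d → toℕ x + key d (parent x) * M) (proj₂ (parent-spec x≢u)) ⟨
    toℕ x + rank (parent x) * M                    ∎
    where open ≡-Reasoning

  rank%M : ∀ {x} → x ≢ u → rank x % M ≡ toℕ x
  rank%M {x} x≢u = begin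
    rank x % M                             ≡⟨ %-congˡ (rank-digits x≢u) ⟩
    (toℕ x + rank (parent x) * M) % M      ≡⟨ [m+kn]%n≡m%n (toℕ x) (rank (parent x)) M ⟩
    toℕ x % M                              ≡⟨ m<n⇒m%n≡m (toℕ<M x) ⟩
    toℕ x                                  ∎
    where open ≡-Reasoning

  rank/M : ∀ {x} → x ≢ u → rank x / M ≡ rank (parent x)
  rank/M {x} x≢u = begin
    rank x / M                                  ≡⟨ /-congˡ (rank-digits x≢u) ⟩
    (toℕ x + rank (parent x) * M) / M           ≡⟨ +-distrib-/-∣ʳ (toℕ x) (n∣m*n (rank (parent x))) ⟩
    toℕ x / M + rank (parent x) * M / M         ≡⟨ cong₂ _+_ (m<n⇒m/n≡0 (toℕ<M x)) (m*n/n≡m (rank (parent x)) M) ⟩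
    rank (parent x)                             ∎
    where open ≡-Reasoning

  same-dist-nonroot : ∀ {x y} → x ≢ u → dist x ≡ dist y → y ≢ u
  same-dist-nonroot x≢u eq refl = x≢u (dist≡0⇒root (trans eq dist-root))

  rank-injective : ∀ {x y} → rank x ≡ rank y → x ≡ y
  rank-injective {x} {y} eq with x ≟ u
  ... | yes refl = sym (dist≡0⇒root (trans (sym (rank≡⇒dist≡ eq)) dist-root))
  ... | no x≢u   = toℕ-injective (begin
    toℕ x       ≡⟨ rank%M x≢u ⟨
    rank x % M  ≡⟨ %-congˡ eq ⟩
    rank y % M  ≡⟨ rank%M (same-dist-nonroot x≢u (rank≡⇒dist≡ eq)) ⟩
    toℕ y       ∎)
    where open ≡-Reasoning

  root-first : ∀ {x} → x ≢ u → rank u < rank x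
  root-first x≢u = dist<⇒rank< (subst₂ _<_ (sym dist-root) (sym (dist-nonroot x≢u)) (s≤s z≤n))

  parent-earlier : ∀ {x} → x ≢ u → rank (parent x) < rank x
  parent-earlier x≢u = dist<⇒rank< (≤-reflexive (parent-dist x≢u))

  parent-earliest : ∀ {x z} → x ≢ u → Adj G x z → rank (parent x) ≤ rank z
  parent-earliest {x} {z} x≢u xz with dist z <? dist x
  ... | no dist-z≮dist-x = <⇒≤ (dist<⇒rank< (<-≤-trans (≤-reflexive (parent-dist x≢u)) (≮⇒≥ dist-z≮dist-x)))
  ... | yes dist-z<dist-x =
    subst₂ _≤_ (cong (λ d → key d (parent x)) (sym (proj₂ (parent-spec x≢u))))
               (cong (λ d → key d z) (sym dist-z))
               (parentAt-least xz dist-z)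
    where
    dist-z : dist z ≡ pred (dist x)
    dist-z = ≤-antisym (≤-pred (subst (dist z <_) (dist-nonroot x≢u) dist-z<dist-x))
                       (≤-pred (subst (_≤ suc (dist z)) (dist-nonroot x≢u) (dist-adj (Adj-sym G xz))))

  parent-mono : ∀ {x y} → x ≢ u → y ≢ u → rank x < rank y → rank (parent x) ≤ rank (parent y)
  parent-mono x≢u y≢u rank-x<rank-y = subst₂ _≤_ (rank/M x≢u) (rank/M y≢u) (/-monoˡ-≤ M (<⇒≤ rank-x<rank-y))

  breadthFirstOrder : BreadthFirstOrder G u
  breadthFirstOrder = record
    { rank            = rank
    ; parent          = parent
    ; rank-injective  = rank-injective
    ; root-first      = root-first
    ; parent-adj      = proj₁ ∘ parent-spec
    ; parent-earlier  = parent-earlier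
    ; parent-earliest = parent-earliest
    ; parent-mono     = parent-mono
    }

-- Automorphisms and twins

module _ {n : ℕ} (G : Graph (Fin n)) where

  to-injective : (φ : Automorphism G) → ∀ {x y} → to φ x ≡ to φ y → x ≡ y
  to-injective φ {x} {y} eq = trans (sym (from∘to φ x)) (trans (cong (from φ) eq) (from∘to φ y))

  Adj-reflect : (φ : Automorphism G) → ∀ {x y} → Adj G (to φ x) (to φ y) → Adj G x y
  Adj-reflect φ {x} {y} = subst T (preserv φ x y)

  Adj-preserve : (φ : Automorphism G) → ∀ {x y} → Adj G x y → Adj G (to φ x) (to φ y)
  Adj-preserve φ {x} {y} = subst T (sym (preserv φ x y))

  inverse : Automorphism G → Automorphism G
  inverse φ = record
    { to      = from φ
    ; from    = to φ
    ; to∘from = from∘to φ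
    ; from∘to = to∘from φ
    ; preserv = λ x y → trans (sym (preserv φ (from φ x) (from φ y))) (cong₂ (adj G) (to∘from φ x) (to∘from φ y))
    }

module _ {n : ℕ} (G : Graph (Fin n)) (rank : Fin n → ℕ) where

  AgreeBefore : Fin n → Fin n → Set
  AgreeBefore w v = ∀ z → rank z < rank w → adj G w z ≡ adj G v z

  agreeBefore? : ∀ w v → Dec (AgreeBefore w v)
  agreeBefore? w v = all? (λ z → (rank z <? rank w) →-dec (adj G w z ≟ᵇ adj G v z))

  SeparatesTwins : ∀ {k} → Pred (Fin n) 0ℓ → (Fin n → Fin k) → Set
  SeparatesTwins S c = ∀ {w v} → S w → S v → rank w < rank v → ¬ Adj G w v → AgreeBefore w v → c w ≢ c v

  -- The image of an earliest moved vertex v is a later twin of v of the same colour.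
  module Rigidity
    (rank-injective : ∀ {x y} → rank x ≡ rank y → x ≡ y)
    {B : Pred (Fin n) 0ℓ} (B? : Decidable B)
    {k : ℕ} {c : Fin n → Fin k} (c-proper : Proper G c) (c-separates : SeparatesTwins (∁ B) c)
    (φ : Automorphism G) (φ-preserves-c : ∀ v → c (to φ v) ≡ c v) (φ-fixes-B : ∀ {x} → B x → to φ x ≡ x)
    where

    fixed-if-earlier-fixed : ∀ v → (∀ z → rank z < rank v → to φ z ≡ z) → to φ v ≡ v
    fixed-if-earlier-fixed v earlier-fixed with B? v | B? (to φ v) | <-cmp (rank v) (rank (to φ v))
    ... | yes Bv | _       | _             = φ-fixes-B Bv
    ... | no _   | yes Bφv | _             = to-injective G φ (φ-fixes-B Bφv)
    ... | no _   | no _    | tri> _ _ φv<v = to-injective G φ (earlier-fixed (to φ v) φv<v)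
    ... | no _   | no _    | tri≈ _ same _ = sym (rank-injective same)
    ... | no ¬Bv | no ¬Bφv | tri< v<φv _ _ =
      contradiction (sym (φ-preserves-c v)) (c-separates ¬Bv ¬Bφv v<φv non-adjacent agree)
      where
      non-adjacent : ¬ Adj G v (to φ v)
      non-adjacent v~φv = c-proper v (to φ v) v~φv (sym (φ-preserves-c v))
      agree : AgreeBefore v (to φ v)
      agree z z<v = trans (sym (preserv φ v z)) (cong (adj G (to φ v)) (earlier-fixed z z<v))

    fixed-below : ∀ m v → rank v < m → to φ v ≡ v
    fixed-below (suc m) v rank-v≤m =
      fixed-if-earlier-fixed v (λ z z<v → fixed-below m z (<-≤-trans z<v (≤-pred rank-v≤m)))

    rigid : ∀ v → to φ v ≡ v
    rigid v = fixed-below (suc (rank v)) v ≤-refl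

module _ {n : ℕ} {G : Graph (Fin n)} {u : Fin n} (order : BreadthFirstOrder G u) where
  open BreadthFirstOrder order

  agree⇒same-parent : ∀ {w v} → w ≢ u → v ≢ u → AgreeBefore G rank w v → parent w ≡ parent v
  agree⇒same-parent {w} {v} w≢u v≢u agree = rank-injective (≤-antisym w-side v-side)
    where
    v-side : rank (parent v) ≤ rank (parent w)
    v-side = parent-earliest v≢u (subst T (agree (parent w) (parent-earlier w≢u)) (parent-adj w≢u))
    w-side : rank (parent w) ≤ rank (parent v)
    w-side = parent-earliest w≢u
      (subst T (sym (agree (parent v) (≤-<-trans v-side (parent-earlier w≢u)))) (parent-adj v≢u))

  -- For x before w, the 4-cycle y w x v with y = parent v is induced unless x ∈ N[y];
  -- for x after w, parent x is squeezed between parent w = y and parent v = y.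
  twin⇒neighbours-near-parent : C4Free G → ∀ {v w x} → v ≢ u → w ≢ u → rank w < rank v →
    ¬ Adj G w v → AgreeBefore G rank w v → Adj G v x → rank x < rank v → x ≡ parent v ⊎ Adj G (parent v) x
  twin⇒neighbours-near-parent c4 {v} {w} {x} v≢u w≢u w<v ¬wv agree vx x<v with <-cmp (rank x) (rank w)
  ... | tri≈ _ same _ = contradiction (subst (λ z → Adj G z v) (rank-injective same) (Adj-sym G vx)) ¬wv
  ... | tri> _ _ w<x  = inj₂ (Adj-sym G (subst (Adj G x) parent-x≡parent-v (parent-adj x≢u)))
    where
    x≢u : x ≢ u
    x≢u refl = <-asym (root-first w≢u) w<x
    parent-x≡parent-v : parent x ≡ parent v
    parent-x≡parent-v = rank-injective (≤-antisym (parent-mono x≢u v≢u x<v)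
      (subst (λ y → rank y ≤ rank (parent x)) (agree⇒same-parent w≢u v≢u agree) (parent-mono w≢u x≢u w<x)))
  ... | tri< x<w _ _ with x ≟ parent v | Adj? G (parent v) x
  ...   | yes x≡y | _      = inj₁ x≡y
  ...   | no _    | yes yx = inj₂ yx
  ...   | no x≢y  | no ¬yx = ⊥-elim (c4 (parent v) w x v (x≢y ∘ sym) (λ { refl → <-irrefl refl w<v })
                                     yw wx (Adj-sym G vx) (parent-adj v≢u) ¬yx ¬wv)
    where
    yw : Adj G (parent v) w
    yw = Adj-sym G (subst (Adj G w) (agree⇒same-parent w≢u v≢u agree) (parent-adj w≢u))
    wx : Adj G w x
    wx = subst T (sym (agree x x<w)) vx

-- The greedy colouring

module ClosedNeighbourhood {n : ℕ} (G : Graph (Fin n)) (u : Fin n) where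

  Near : Pred (Fin n) 0ℓ
  Near x = T (closedNbhd G u x)

  near? : Decidable Near
  near? x = T? (closedNbhd G u x)

  Far : Pred (Fin n) 0ℓ
  Far = ∁ Near

  near-root : Near u
  near-root with u ≟ u
  ... | yes _   = _
  ... | no u≢u = contradiction refl u≢u

  near-adj : ∀ {x} → Adj G u x → Near x
  near-adj {x} ux with x ≟ u
  ... | yes _ = _
  ... | no _  = ux

  near-elim : ∀ {x} → Near x → x ≡ u ⊎ Adj G u x
  near-elim {x} near-x with x ≟ u
  ... | yes x≡u = inj₁ x≡u
  ... | no _    = inj₂ near-x

  far⇒nonroot : ∀ {x} → Far x → x ≢ u
  far⇒nonroot far-x refl = far-x near-root

  Vertex : Set
  Vertex = Σ (Fin n) Near

  vertex-≡ : ∀ {x y} {p : Near x} {q : Near y} → x ≡ y → _≡_ {A = Vertex} (x , p) (y , q)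
  vertex-≡ {x} {p = p} {q} refl = cong (x ,_) (T-irrelevant p q)

  near-preserved : (φ : Automorphism G) → to φ u ≡ u → ∀ {x} → Near x → Near (to φ x)
  near-preserved φ φu≡u near-x with near-elim near-x
  ... | inj₁ refl = subst Near (sym φu≡u) near-root
  ... | inj₂ ux   = near-adj (subst (λ z → Adj G z _) φu≡u (Adj-preserve G φ ux))

  restrict : (φ : Automorphism G) → to φ u ≡ u → Automorphism (induced G (closedNbhd G u))
  restrict φ φu≡u = record
    { to      = λ (x , near-x) → to φ x , near-preserved φ φu≡u near-x
    ; from    = λ (x , near-x) → from φ x , near-preserved (inverse G φ) ψu≡u near-x
    ; to∘from = λ (x , _) → vertex-≡ (to∘from φ x)
    ; from∘to = λ (x , _) → vertex-≡ (from∘to φ x)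
    ; preserv = λ (x , _) (y , _) → preserv φ x y
    }
    where
    ψu≡u : from φ u ≡ u
    ψu≡u = trans (cong (from φ) (sym φu≡u)) (from∘to φ u)

module GreedyExtension
  {n : ℕ} (G : Graph (Fin n)) (c4 : C4Free G) (u : Fin n) (order : BreadthFirstOrder G u)
  (c₀ : Σ (Fin n) (λ v → T (closedNbhd G u v)) → Fin (Δ G))
  (c₀-proper : Proper (induced G (closedNbhd G u)) c₀)
  where

  open BreadthFirstOrder order
  open ClosedNeighbourhood G u

  Colour : Set
  Colour = Fin (suc (Δ G))

  Processed : ℕ → Pred (Fin n) 0ℓ
  Processed t x = Near x ⊎ rank x < t

  processed? : ∀ t → Decidable (Processed t)
  processed? t x = near? x ⊎-dec (rank x <? t)

  processed-suc⁺ : ∀ {t x} → Processed t x → Processed (suc t) x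
  processed-suc⁺ (inj₁ near-x)   = inj₁ near-x
  processed-suc⁺ (inj₂ rank-x<t) = inj₂ (m<n⇒m<1+n rank-x<t)

  SeesAllColours : ℕ → (Fin n → Colour) → Fin n → Set
  SeesAllColours t c v = ∀ j → ∃ λ x → Adj G v x × Processed t x × c x ≡ Fin.suc j

  sees-all-suc : ∀ {t c c′ v} → (∀ {x} → Processed t x → c′ x ≡ c x) →
                 SeesAllColours t c v → SeesAllColours (suc t) c′ v
  sees-all-suc c′≗c sees j = let (x , vx , px , cx) = sees j in x , vx , processed-suc⁺ px , trans (c′≗c px) cx

  -- Colour zero is reserved: in N[u] only u gets it, and a later vertex may take it only if
  -- it sees every other colour, which is what keeps automorphisms from moving u.
  record Invariant (t : ℕ) (c : Fin n → Colour) : Set where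
    field
      proper        : ∀ {x y} → Processed t x → Processed t y → Adj G x y → c x ≢ c y
      root-colour   : c u ≡ Fin.zero
      near-colour   : ∀ {a} (near-a : Near a) → a ≢ u → c a ≡ Fin.suc (c₀ (a , near-a))
      separates     : SeparatesTwins G rank (λ x → Far x × rank x < t) c
      zero-sees-all : ∀ {v} → Far v → rank v < t → c v ≡ Fin.zero → SeesAllColours t c v

  processed-suc⁻ : ∀ {t x} → Processed (suc t) x → Processed t x ⊎ (Far x × rank x ≡ t)
  processed-suc⁻ (inj₁ near-x) = inj₁ (inj₁ near-x)
  processed-suc⁻ {x = x} (inj₂ rank-x≤t) with m≤n⇒m<n∨m≡n (≤-pred rank-x≤t) | near? x
  ... | inj₁ rank-x<t | _          = inj₁ (inj₂ rank-x<t)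
  ... | inj₂ _        | yes near-x = inj₁ (inj₁ near-x)
  ... | inj₂ rank-x≡t | no far-x   = inj₂ (far-x , rank-x≡t)

  far-processed : ∀ {t x} → Far x → Processed t x → rank x < t
  far-processed far-x (inj₁ near-x)   = contradiction near-x far-x
  far-processed far-x (inj₂ rank-x<t) = rank-x<t

  near-before-far : ∀ {a w} → Near a → Far w → rank a < rank w
  near-before-far {a} {w} near-a far-w with near-elim near-a
  ... | inj₁ refl = root-first (far⇒nonroot far-w)
  ... | inj₂ ua with <-cmp (rank a) (rank w)
  ...   | tri< a<w _ _  = a<w
  ...   | tri≈ _ same _ = contradiction (subst Near (rank-injective same) near-a) far-w
  ...   | tri> _ _ w<a  = contradiction (parent-mono (far⇒nonroot far-w) a≢u w<a) (<⇒≱ parent-a<parent-w)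
    where
    a≢u : a ≢ u
    a≢u refl = Adj-irrefl G ua
    parent-w≢u : parent w ≢ u
    parent-w≢u parent-w≡u = far-w (near-adj (Adj-sym G (subst (Adj G w) parent-w≡u (parent-adj (far⇒nonroot far-w)))))
    parent-a<parent-w : rank (parent a) < rank (parent w)
    parent-a<parent-w = ≤-<-trans (parent-earliest a≢u (Adj-sym G ua)) (root-first parent-w≢u)

  initialColour : ∀ x → Dec (x ≡ u) → Dec (Adj G u x) → Colour
  initialColour x (no _) (yes ux) = Fin.suc (c₀ (x , near-adj ux))
  initialColour x _      _        = Fin.zero

  initial : Fin n → Colour
  initial x = initialColour x (x ≟ u) (Adj? G u x)

  initial-root : ∀ {x} → x ≡ u → initial x ≡ Fin.zero
  initial-root refl with u ≟ u
  ... | yes _   = refl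
  ... | no u≢u = contradiction refl u≢u

  initial-near : ∀ {a} (near-a : Near a) → a ≢ u → initial a ≡ Fin.suc (c₀ (a , near-a))
  initial-near {a} near-a a≢u = by-cases (a ≟ u) (Adj? G u a)
    where
    by-cases : ∀ d e → initialColour a d e ≡ Fin.suc (c₀ (a , near-a))
    by-cases (yes a≡u) _        = contradiction a≡u a≢u
    by-cases (no _)    (yes _)  = cong (Fin.suc ∘ c₀) (vertex-≡ refl)
    by-cases (no _)    (no ¬ua) = ⊥-elim ([ a≢u , ¬ua ] (near-elim near-a))

  initial-proper : ∀ {x y} → Near x → Near y → Adj G x y → initial x ≢ initial y
  initial-proper {x} {y} near-x near-y xy eq with near-elim near-x | near-elim near-y
  ... | inj₁ x≡u | inj₁ y≡u = Adj-irrefl G (subst₂ (Adj G) x≡u y≡u xy)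
  ... | inj₁ x≡u | inj₂ uy  = 0≢1+n (trans (sym (initial-root x≡u)) (trans eq (initial-near near-y (Adj⇒≢ G uy ∘ sym))))
  ... | inj₂ ux  | inj₁ y≡u = 0≢1+n (trans (sym (initial-root y≡u)) (trans (sym eq) (initial-near near-x (Adj⇒≢ G ux ∘ sym))))
  ... | inj₂ ux  | inj₂ uy  = c₀-proper (x , near-x) (y , near-y) xy (suc-injective (begin
    Fin.suc (c₀ (x , near-x)) ≡⟨ initial-near near-x (Adj⇒≢ G ux ∘ sym) ⟨
    initial x                 ≡⟨ eq ⟩
    initial y                 ≡⟨ initial-near near-y (Adj⇒≢ G uy ∘ sym) ⟩
    Fin.suc (c₀ (y , near-y)) ∎))
    where open ≡-Reasoning

  initial-invariant : Invariant 0 initial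
  initial-invariant = record
    { proper        = λ { (inj₁ near-x) (inj₁ near-y) → initial-proper near-x near-y }
    ; root-colour   = initial-root refl
    ; near-colour   = initial-near
    ; separates     = λ { _ (_ , ()) }
    ; zero-sees-all = λ _ ()
    }

  module Step {t : ℕ} {c : Fin n → Colour} (inv : Invariant t c) where
    open Invariant inv

    skip : (∀ {v} → Far v → rank v ≢ t) → Invariant (suc t) c
    skip nothing-at-t = record
      { proper        = λ px py → proper (earlier px) (earlier py)
      ; root-colour   = root-colour
      ; near-colour   = near-colour
      ; separates     = λ (far-w , w≤t) (far-v , v≤t) →
                          separates (far-w , earlier-far far-w w≤t) (far-v , earlier-far far-v v≤t)
      ; zero-sees-all = λ far-v v≤t cv≡0 → sees-all-suc (λ _ → refl) (zero-sees-all far-v (earlier-far far-v v≤t) cv≡0)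
      }
      where
      earlier : ∀ {x} → Processed (suc t) x → Processed t x
      earlier px with processed-suc⁻ px
      ... | inj₁ px′              = px′
      ... | inj₂ (far-x , rank-x) = contradiction rank-x (nothing-at-t far-x)
      earlier-far : ∀ {x} → Far x → rank x < suc t → rank x < t
      earlier-far far-x rank-x≤t = far-processed far-x (earlier (inj₂ rank-x≤t))

    module Assign {v : Fin n} (far-v : Far v) (rank-v : rank v ≡ t) where

      v≢u : v ≢ u
      v≢u = far⇒nonroot far-v

      EarlierTwin : Pred (Fin n) 0ℓ
      EarlierTwin x = Far x × ¬ Adj G x v × AgreeBefore G rank x v

      Forbidden : Pred (Fin n) 0ℓ
      Forbidden x = Processed t x × (Adj G v x ⊎ EarlierTwin x)

      forbidden? : Decidable Forbidden
      forbidden? x = processed? t x ×-dec (Adj? G v x ⊎-dec (¬? (near? x) ×-dec ¬? (Adj? G x v) ×-dec agreeBefore? G rank x v))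

      unprocessed-v : ¬ Processed t v
      unprocessed-v (inj₁ near-v)   = far-v near-v
      unprocessed-v (inj₂ rank-v<t) = <-irrefl rank-v rank-v<t

      processed⇒before-v : ∀ {x} → Processed t x → rank x < rank v
      processed⇒before-v (inj₁ near-x)   = near-before-far near-x far-v
      processed⇒before-v (inj₂ rank-x<t) = subst (_ <_) (sym rank-v) rank-x<t

      processed⇒≢v : ∀ {x} → Processed t x → x ≢ v
      processed⇒≢v px refl = unprocessed-v px

      #forbidden : ℕ
      #forbidden = count forbidden? (allFin n)

      #forbidden-without-twins : (∀ {x} → Processed t x → ¬ EarlierTwin x) → #forbidden ≤ Δ G
      #forbidden-without-twins no-twin = ≤-trans (count-mono forbidden? (Adj? G v) neighbour (allFin n)) (degree≤Δ G v)
        where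
        neighbour : Forbidden ⊆ Adj G v
        neighbour (_  , inj₁ vx)    = vx
        neighbour (px , inj₂ twin) = contradiction twin (no-twin px)

      -- With an earlier twin w, the forbidden vertices lie in N[y] for y = parent v, which
      -- also contains the two vertices v and parent y that are not forbidden.
      module WithTwin {w : Fin n} (pw : Processed t w) (twin-w : EarlierTwin w) where

        y : Fin n
        y = parent v

        p : Fin n
        p = parent y

        y≢u : y ≢ u
        y≢u y≡u = far-v (near-adj (Adj-sym G (subst (Adj G v) y≡u (parent-adj v≢u))))

        twin⇒parent-y : ∀ {x} → EarlierTwin x → parent x ≡ y
        twin⇒parent-y (far-x , _ , agree-x) = agree⇒same-parent order (far⇒nonroot far-x) v≢u agree-x

        forbidden⊆N[y] : ∀ {x} → Forbidden x → x ≡ y ⊎ Adj G y x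
        forbidden⊆N[y] (px , inj₁ vx) =
          let (far-w , ¬wv , agree-w) = twin-w
          in twin⇒neighbours-near-parent order c4 v≢u (far⇒nonroot far-w) (processed⇒before-v pw) ¬wv agree-w
                                         vx (processed⇒before-v px)
        forbidden⊆N[y] {x} (px , inj₂ twin@(far-x , _)) =
          inj₂ (Adj-sym G (subst (Adj G x) (twin⇒parent-y twin) (parent-adj (far⇒nonroot far-x))))

        p<y : rank p < rank y
        p<y = parent-earlier y≢u

        p-unforbidden : ¬ (Forbidden p ⊎ p ≡ v)
        p-unforbidden (inj₁ (_ , inj₁ vp)) = <⇒≱ p<y (parent-earliest v≢u vp)
        p-unforbidden (inj₁ (_ , inj₂ twin@(far-p , _))) =
          <-asym p<y (subst (λ z → rank z < rank p) (twin⇒parent-y twin) (parent-earlier (far⇒nonroot far-p)))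
        p-unforbidden (inj₂ p≡v) = <-asym p<y (subst (λ z → rank y < rank z) (sym p≡v) (parent-earlier v≢u))

        F∪v? : Decidable (Forbidden ∪ (_≡ v))
        F∪v? = forbidden? ∪? (_≟ v)

        F∪v∪p? : Decidable ((Forbidden ∪ (_≡ v)) ∪ (_≡ p))
        F∪v∪p? = F∪v? ∪? (_≟ p)

        N[y]? : Decidable ((_≡ y) ∪ Adj G y)
        N[y]? = (_≟ y) ∪? Adj? G y

        F∪v∪p⊆N[y] : (Forbidden ∪ (_≡ v)) ∪ (_≡ p) ⊆ (_≡ y) ∪ Adj G y
        F∪v∪p⊆N[y] (inj₁ (inj₁ fx))   = forbidden⊆N[y] fx
        F∪v∪p⊆N[y] (inj₁ (inj₂ refl)) = inj₂ (Adj-sym G (parent-adj v≢u))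
        F∪v∪p⊆N[y] (inj₂ refl)        = inj₂ (parent-adj y≢u)

        #forbidden<Δ : suc #forbidden ≤ Δ G
        #forbidden<Δ = ≤-pred (begin
          suc (suc #forbidden)
            ≤⟨ s≤s (count-strict-mono forbidden? F∪v? inj₁ (∈-allFin v) (inj₂ refl) (unprocessed-v ∘ proj₁)) ⟩
          suc (count F∪v? (allFin n))
            ≤⟨ count-strict-mono F∪v? F∪v∪p? inj₁ (∈-allFin p) (inj₂ refl) p-unforbidden ⟩
          count F∪v∪p? (allFin n)              ≤⟨ count-mono F∪v∪p? N[y]? F∪v∪p⊆N[y] (allFin n) ⟩
          count N[y]? (allFin n)               ≤⟨ count-∪ (_≟ y) (Adj? G y) (allFin n) ⟩
          count (_≟ y) (allFin n) + degree G y ≤⟨ +-mono-≤ (count-≟-≤1 y (allFin⁺ n)) (degree≤Δ G y) ⟩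
          suc (Δ G)                            ∎)
          where open ≤-Reasoning

      open import Data.List.Membership.DecPropositional (_≟_ {suc (Δ G)}) using (_∈?_)

      record Admissible (col : Colour) : Set where
        field
          avoids-forbidden : ∀ {x} → Forbidden x → c x ≢ col
          zero⇒sees-all    : col ≡ Fin.zero → SeesAllColours t c v

      usedColours : List Colour
      usedColours = map c (filter forbidden? (allFin n))

      used : ∀ {x} → Forbidden x → c x ∈ usedColours
      used fx = ∈-map⁺ c (∈-filter⁺ forbidden? (∈-allFin _) fx)

      used⁻ : ∀ {col} → col ∈ usedColours → ∃ λ x → Forbidden x × col ≡ c x
      used⁻ col∈used with ∈-map⁻ c col∈used
      ... | x , x∈filter , col≡cx = x , proj₂ (∈-filter⁻ forbidden? {xs = allFin n} x∈filter) , col≡cx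

      |usedColours| : length usedColours ≡ #forbidden
      |usedColours| = trans (length-map c (filter forbidden? (allFin n))) (length-filter≡count forbidden? (allFin n))

      unused⇒admissible : ∀ {col} → col ∉ usedColours → (col ≡ Fin.zero → SeesAllColours t c v) → Admissible col
      unused⇒admissible col∉used zero-case = record
        { avoids-forbidden = λ fx cx≡col → col∉used (subst (_∈ usedColours) cx≡col (used fx))
        ; zero⇒sees-all    = zero-case
        }

      -- If every non-zero colour is forbidden then, by counting, v has no earlier twin; so
      -- only neighbours of v are forbidden, they cannot use all Δ + 1 colours, and zero is free.
      admissible : ∃ Admissible
      admissible with any? (λ j → ¬? (Fin.suc j ∈? usedColours))
      ... | yes (j , suc-j∉used) = Fin.suc j , unused⇒admissible suc-j∉used (λ ())
      ... | no all-nonzero-used  = Fin.zero , unused⇒admissible zero∉used zero-sees-all-colours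
        where
        nonzero-used : ∀ j → Fin.suc j ∈ usedColours
        nonzero-used j = decidable-stable (Fin.suc j ∈? usedColours) (λ suc-j∉used → all-nonzero-used (j , suc-j∉used))
        Δ≤#forbidden : Δ G ≤ #forbidden
        Δ≤#forbidden = subst (Δ G ≤_) |usedColours| (cover⇒≤length suc-injective nonzero-used)
        no-twin : ∀ {x} → Processed t x → ¬ EarlierTwin x
        no-twin px twin = <-irrefl refl (<-≤-trans (WithTwin.#forbidden<Δ px twin) Δ≤#forbidden)
        zero∉used : Fin.zero ∉ usedColours
        zero∉used zero∈used = <-irrefl refl (<-≤-trans
          (subst (Δ G <_) |usedColours| (cover⇒≤length id every-colour-used))
          (#forbidden-without-twins no-twin))
          where
          every-colour-used : ∀ col → col ∈ usedColours
          every-colour-used Fin.zero    = zero∈used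
          every-colour-used (Fin.suc j) = nonzero-used j
        zero-sees-all-colours : Fin.zero ≡ Fin.zero → SeesAllColours t c v
        zero-sees-all-colours _ j with used⁻ (nonzero-used j)
        ... | x , (px , inj₁ vx)    , suc-j≡cx = x , vx , px , sym suc-j≡cx
        ... | x , (px , inj₂ twin) , _         = contradiction twin (no-twin px)

      module _ {col : Colour} (col-admissible : Admissible col) where
        open Admissible col-admissible

        c′ : Fin n → Colour
        c′ = updateAt c v (const col)

        c′-v : c′ v ≡ col
        c′-v = updateAt-updates v c

        c′-old : ∀ {x} → Processed t x → c′ x ≡ c x
        c′-old px = updateAt-minimal _ v c (processed⇒≢v px)

        processed-suc⁻-v : ∀ {x} → Processed (suc t) x → Processed t x ⊎ x ≡ v
        processed-suc⁻-v px with processed-suc⁻ px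
        ... | inj₁ px′         = inj₁ px′
        ... | inj₂ (_ , rank-x) = inj₂ (rank-injective (trans rank-x (sym rank-v)))

        proper′ : ∀ {x y} → Processed (suc t) x → Processed (suc t) y → Adj G x y → c′ x ≢ c′ y
        proper′ px py xy with processed-suc⁻-v px | processed-suc⁻-v py
        ... | inj₁ px′  | inj₁ py′  = λ eq →
          proper px′ py′ xy (trans (sym (c′-old px′)) (trans eq (c′-old py′)))
        ... | inj₂ refl | inj₁ py′  = λ eq →
          avoids-forbidden (py′ , inj₁ xy) (trans (sym (c′-old py′)) (trans (sym eq) c′-v))
        ... | inj₁ px′  | inj₂ refl = λ eq →
          avoids-forbidden (px′ , inj₁ (Adj-sym G xy)) (trans (sym (c′-old px′)) (trans eq c′-v))
        ... | inj₂ refl | inj₂ refl = λ _ → Adj-irrefl G xy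

        separates′ : SeparatesTwins G rank (λ x → Far x × rank x < suc t) c′
        separates′ {w} {v′} (far-w , _) (far-v′ , v′≤t) w<v′ ¬wv′ agree with m≤n⇒m<n∨m≡n (≤-pred v′≤t)
        ... | inj₁ v′<t = λ eq → separates (far-w , <-trans w<v′ v′<t) (far-v′ , v′<t) w<v′ ¬wv′ agree
                                   (trans (sym (c′-old (inj₂ (<-trans w<v′ v′<t)))) (trans eq (c′-old (inj₂ v′<t))))
        ... | inj₂ v′-at-t with rank-injective (trans v′-at-t (sym rank-v))
        ...   | refl = λ eq → avoids-forbidden (pw , inj₂ (far-w , ¬wv′ , agree)) (trans (sym (c′-old pw)) (trans eq c′-v))
          where
          pw : Processed t w
          pw = inj₂ (subst (rank w <_) v′-at-t w<v′)

        zero-sees-all′ : ∀ {v′} → Far v′ → rank v′ < suc t → c′ v′ ≡ Fin.zero → SeesAllColours (suc t) c′ v′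
        zero-sees-all′ far-v′ v′≤t c′v′≡0 with m≤n⇒m<n∨m≡n (≤-pred v′≤t)
        ... | inj₁ v′<t = sees-all-suc c′-old (zero-sees-all far-v′ v′<t (trans (sym (c′-old (inj₂ v′<t))) c′v′≡0))
        ... | inj₂ v′-at-t with rank-injective (trans v′-at-t (sym rank-v))
        ...   | refl = sees-all-suc c′-old (zero⇒sees-all (trans (sym c′-v) c′v′≡0))

        invariant′ : Invariant (suc t) c′
        invariant′ = record
          { proper        = proper′
          ; root-colour   = trans (c′-old (inj₁ near-root)) root-colour
          ; near-colour   = λ near-a a≢u → trans (c′-old (inj₁ near-a)) (near-colour near-a a≢u)
          ; separates     = separates′
          ; zero-sees-all = zero-sees-all′
          }

      assign : ∃ (Invariant (suc t))
      assign = c′ (proj₂ admissible) , invariant′ (proj₂ admissible)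

  extend : ∀ t → ∃ (Invariant t) → ∃ (Invariant (suc t))
  extend t (c , inv) with any? (λ v → ¬? (near? v) ×-dec (rank v ≟ℕ t))
  ... | yes (v , far-v , rank-v) = Step.Assign.assign inv far-v rank-v
  ... | no nothing-at-t          = c , Step.skip inv (λ far-v rank-v → nothing-at-t (_ , far-v , rank-v))

  colouringUpTo : ∀ t → ∃ (Invariant t)
  colouringUpTo zero    = initial , initial-invariant
  colouringUpTo (suc t) = extend t (colouringUpTo t)

  finalStage : ℕ
  finalStage = suc (foldr _⊔_ 0 (map rank (allFin n)))

  all-processed : ∀ x → Processed finalStage x
  all-processed x = inj₂ (s≤s (∈⇒≤foldr⊔ (∈-map⁺ rank (∈-allFin x))))

  colouring : Fin n → Colour
  colouring = proj₁ (colouringUpTo finalStage)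

  open Invariant (proj₂ (colouringUpTo finalStage))

  colouring-proper : Proper G colouring
  colouring-proper x y = proper (all-processed x) (all-processed y)

  colouring-separates : SeparatesTwins G rank Far colouring
  colouring-separates {w} {v} far-w far-v =
    separates (far-w , far-processed far-w (all-processed w)) (far-v , far-processed far-v (all-processed v))

  module Automorphisms (c₀-distinguishing : Distinguishing (induced G (closedNbhd G u)) c₀) where

    module _ (φ : Automorphism G) (φ-preserves : ∀ v → colouring (to φ v) ≡ colouring v) where

      colour-φu : colouring (to φ u) ≡ Fin.zero
      colour-φu = trans (φ-preserves u) root-colour

      -- A far φ u, being coloured zero, would see the colour 1 + c₀ u; pulling that
      -- neighbour back by φ gives a neighbour of u with the same c₀-colour as u.
      φu-not-far : ¬ Far (to φ u)
      φu-not-far far with zero-sees-all far (far-processed far (all-processed (to φ u))) colour-φu (c₀ (u , near-root))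
      ... | x , φu~x , _ , colour-x = c₀-proper (u , near-root) (x′ , near-x′) u~x′ (sym (suc-injective (begin
        Fin.suc (c₀ (x′ , near-x′))  ≡⟨ near-colour near-x′ (Adj⇒≢ G u~x′ ∘ sym) ⟨
        colouring x′                 ≡⟨ φ-preserves x′ ⟨
        colouring (to φ x′)          ≡⟨ cong colouring (to∘from φ x) ⟩
        colouring x                  ≡⟨ colour-x ⟩
        Fin.suc (c₀ (u , near-root)) ∎)))
        where
        open ≡-Reasoning
        x′ : Fin n
        x′ = from φ x
        u~x′ : Adj G u x′
        u~x′ = Adj-reflect G φ (subst (Adj G (to φ u)) (sym (to∘from φ x)) φu~x)
        near-x′ : Near x′
        near-x′ = near-adj u~x′

      φ-root : to φ u ≡ u
      φ-root with near? (to φ u) | to φ u ≟ u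
      ... | _        | yes φu≡u = φu≡u
      ... | yes near | no φu≢u  = ⊥-elim (0≢1+n (trans (sym colour-φu) (near-colour near φu≢u)))
      ... | no far   | no _     = contradiction far φu-not-far

      φ-near : ∀ {x} → Near x → to φ x ≡ x
      φ-near {x} near-x = cong proj₁ (c₀-distinguishing ψ ψ-preserves (x , near-x))
        where
        ψ : Automorphism (induced G (closedNbhd G u))
        ψ = restrict φ φ-root
        ψ-preserves : ∀ a → c₀ (to ψ a) ≡ c₀ a
        ψ-preserves (a , near-a) = by-cases (near-elim near-a)
          where
          open ≡-Reasoning
          by-cases : a ≡ u ⊎ Adj G u a → c₀ (to ψ (a , near-a)) ≡ c₀ (a , near-a)
          by-cases (inj₁ a≡u) = cong c₀ (vertex-≡ (trans (cong (to φ) a≡u) (trans φ-root (sym a≡u))))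
          by-cases (inj₂ ua)  = suc-injective (begin
            Fin.suc (c₀ (to ψ (a , near-a))) ≡⟨ near-colour _ (a≢u ∘ to-injective G φ ∘ flip trans (sym φ-root)) ⟨
            colouring (to φ a)               ≡⟨ φ-preserves a ⟩
            colouring a                      ≡⟨ near-colour near-a a≢u ⟩
            Fin.suc (c₀ (a , near-a))        ∎)
            where
            a≢u : a ≢ u
            a≢u = Adj⇒≢ G ua ∘ sym

      φ-identity : ∀ v → to φ v ≡ v
      φ-identity = Rigidity.rigid G rank rank-injective near? colouring-proper colouring-separates φ φ-preserves φ-near

    colouring-distinguishing : Distinguishing G colouring
    colouring-distinguishing = φ-identity

mainTheorem3 : (n : ℕ) (G : Graph (Fin n)) → Connected G → C4Free G →
    (u : Fin n) → χD≤ (induced G (closedNbhd G u)) (Δ G) →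
    χD≤ G (suc (Δ G))
mainTheorem3 n G connected c4 u (c₀ , c₀-proper , c₀-distinguishing) =
  colouring , colouring-proper , colouring-distinguishing
  where
  open GreedyExtension G c4 u (BreadthFirstSearch.breadthFirstOrder G connected u) c₀ c₀-proper
  open Automorphisms c₀-distinguishing
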